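{- Let $m\ge 0$ and $n>m+1$ be integers, and let $G$ be a graph whose vertex set has a partition into sets $V_{i,j}$, $i,j\in\{0,\ldots,n\}$, with the following properties: (1) $|V_{i,0}|\le 1$ for all $i\ge 1$; (2) $|V_{0,j}|\le 1$ for all $j\ge 1$; (3) $|V_{i,j}|\ge 1$ for all $i,j\ge 1$; (4) $G[\bigcup_{j=0}^n V_{i,j}]$ is connected for all $i\ge 1$; (5) $G[\bigcup_{i=0}^n V_{i,j}]$ is connected for all $j\ge 1$; (6) for $i,j,k\ge 1$, if a vertex of $V_{k,0}$ is adjacent to a vertex of $V_{i,j}$ then $i\le k$; (7) for $i,j,k\ge 1$, if a vertex of $V_{0,k}$ is adjacent to a vertex of $V_{i,j}$ then $j\le k$; (8) for $i,j,k,\ell\ge 1$, if a vertex of $V_{i,j}$ is adjacent to a vertex of $V_{k,\ell}$ then $|k-i|\le m$ and $|\ell-j|\le m$. Then the clique-width of $G$ is at least $\lfloor \frac{n-1}{m+1}\rfloor+1$.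
   Context: All graphs are finite, simple and undirected; $G[S]$ denotes the subgraph of $G$ induced by $S\subseteq V(G)$; sets in the partition may be empty unless stated otherwise. The clique-width of a graph $G$ is the minimum number of labels needed to construct $G$ using the operations: create a single vertex with label $i$; take the disjoint union of two labelled graphs; add all edges between vertices labelled $i$ and vertices labelled $j$ ($i\neq j$); rename label $i$ to $j$. -}

module Defs where

open import Data.Nat using (ℕ; zero; suc; _+_; _≤_)
open import Data.Fin using (Fin; splitAt; _≟_)
open import Data.Sum using (_⊎_; inj₁; inj₂)
open import Data.Product using (_×_; Σ; _,_)
open import Data.Empty using (⊥)
open import Relation.Binary.PropositionalEquality using (_≡_; _≢_)
open import Relation.Nullary using (¬_; yes; no)

record Graph : Set₁ where
  field
    V     : ℕ
    Adj   : Fin V → Fin V → Set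
    sym   : ∀ {x y} → Adj x y → Adj y x
    irrefl : ∀ {x} → ¬ Adj x x
open Graph public

data WalkIn (G : Graph) (S : Fin (V G) → Set) : Fin (V G) → Fin (V G) → Set where
  stay : ∀ {x} → S x → WalkIn G S x x
  step : ∀ {x y z} → S x → Adj G x y → WalkIn G S y z → WalkIn G S x z

InducedConnected : (G : Graph) → (Fin (V G) → Set) → Set
InducedConnected G S = ∀ x y → S x → S y → WalkIn G S x y

data CWExpr (k : ℕ) : Set where
  vertex : Fin k → CWExpr k
  union  : CWExpr k → CWExpr k → CWExpr k
  join   : (i j : Fin k) → i ≢ j → CWExpr k → CWExpr k
  rename : (i j : Fin k) → CWExpr k → CWExpr k

size : ∀ {k} → CWExpr k → ℕ
size (vertex _)       = 1
size (union e₁ e₂)    = size e₁ + size e₂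
size (join _ _ _ e)   = size e
size (rename _ _ e)   = size e

label : ∀ {k} (e : CWExpr k) → Fin (size e) → Fin k
label (vertex i) _ = i
label (union e₁ e₂) x with splitAt (size e₁) x
... | inj₁ a = label e₁ a
... | inj₂ b = label e₂ b
label (join _ _ _ e) x = label e x
label (rename i j e) x with label e x ≟ i
... | yes _ = j
... | no  _ = label e x

edge : ∀ {k} (e : CWExpr k) → Fin (size e) → Fin (size e) → Set
edge (vertex _) _ _ = ⊥
edge (union e₁ e₂) x y with splitAt (size e₁) x | splitAt (size e₁) y
... | inj₁ a | inj₁ b = edge e₁ a b
... | inj₂ a | inj₂ b = edge e₂ a b
... | inj₁ _ | inj₂ _ = ⊥
... | inj₂ _ | inj₁ _ = ⊥
edge (join i j _ e) x y =
  edge e x y ⊎ ((label e x ≡ i × label e y ≡ j) ⊎ (label e x ≡ j × label e y ≡ i))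
edge (rename _ _ e) x y = edge e x y

record Realizes {k : ℕ} (e : CWExpr k) (G : Graph) : Set where
  field
    to      : Fin (size e) → Fin (V G)
    from    : Fin (V G) → Fin (size e)
    to∘from : ∀ v → to (from v) ≡ v
    from∘to : ∀ x → from (to x) ≡ x
    adj→    : ∀ x y → edge e x y → Adj G (to x) (to y)
    adj←    : ∀ x y → Adj G (to x) (to y) → edge e x y

CliqueWidthAtLeast : Graph → ℕ → Set
CliqueWidthAtLeast G c = ∀ k (e : CWExpr k) → Realizes e G → c ≤ k

-- The root builds every row and column and a single vertex builds
-- none, so some union node builds a whole row or column while neither child builds one; by
-- symmetry say it builds the row R.  Every column C meets R inside the node but leaves the child
-- containing that meeting point, so by connectivity of C some edge of C has one end built by the
-- node without being built there itself; it must be created later, through the label of that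
-- end.  The columns 1, m+2, 2m+3, … — there are ⌊(n−1)/(m+1)⌋+1 of them — are pairwise more than
-- m apart, and by (6)–(8) an edge from one of them to a later one ends in row 0.  If the pending
-- edges of two of these columns had the same label, the later joins would also join each of them
-- to the outer end of the other, putting both ends of the right-hand pending edge into the cell
-- V_{0,j} of its column, which has at most one vertex.  Hence these labels are pairwise distinct.
module Submission where

open import Defs
open import Data.Nat using (ℕ; suc; _+_; _∸_; _≤_; _<_; ∣_-_∣)
open import Data.Nat.DivMod using (_/_)
open import Data.Fin using (Fin; toℕ; zero)
open import Data.Product using (_×_; _,_; ∃)
open import Relation.Binary.PropositionalEquality using (_≡_)

open import Data.Nat using (_*_; _≰_; _≤?_; z≤n; s≤s; z<s)
open import Data.Nat.Properties
  using (≤-trans; <⇒≱; <-≤-trans; ≮⇒≥; m<m+n; m+n≤o⇒m≤o; m+n≤o⇒m≤o∸n; m≤n⇒∣n-m∣≡n∸m; m+[n∸m]≡n;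
         +-comm; *-monoˡ-≤; m<1+n⇒m≤n; module ≤-Reasoning)
open import Data.Nat.DivMod using (m/n*n≤m)
open import Data.Fin using (splitAt; _↑ˡ_; _↑ʳ_; _≟_; fromℕ<) renaming (suc to fsuc; _<_ to _<ᶠ_)
open import Data.Fin.Properties
  using (splitAt-↑ˡ; splitAt-↑ʳ; splitAt⁻¹-↑ˡ; splitAt⁻¹-↑ʳ; toℕ-fromℕ<; toℕ<n;
         any?; all?; ¬∀⟶∃¬; pigeonhole)
open import Data.Product using (∃₂; proj₁; proj₂)
open import Data.Sum using (_⊎_; inj₁; inj₂; [_,_]′)
open import Data.Empty using (⊥-elim)
open import Function using (_∘_; id)
open import Relation.Nullary using (¬_; Dec; yes; no; contradiction)
open import Relation.Nullary.Decidable using (_×-dec_; _⊎-dec_; _→-dec_)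
open import Relation.Unary using (Decidable)
open import Relation.Binary.PropositionalEquality
  using (_≢_; refl; trans; cong; cong₂; subst; subst₂)
import Relation.Binary.PropositionalEquality as ≡

module _ {a b : ℕ} (d : ℕ) (gap : a + suc d ≤ b) where

  m+[1+o]≤n⇒n≰m : b ≰ a
  m+[1+o]≤n⇒n≰m = <⇒≱ (<-≤-trans (m<m+n a z<s) gap)

  m+[1+o]≤n⇒∣n-m∣≰o : ∣ b - a ∣ ≰ d
  m+[1+o]≤n⇒∣n-m∣≰o rewrite m≤n⇒∣n-m∣≡n∸m (m+n≤o⇒m≤o a gap) =
    <⇒≱ (m+n≤o⇒m≤o∸n (suc d) (subst (_≤ b) (+-comm a (suc d)) gap))

zero-or-positive : ∀ {n} (c : Fin (suc n)) → c ≡ zero ⊎ 1 ≤ toℕ c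
zero-or-positive zero     = inj₁ refl
zero-or-positive (fsuc c) = inj₂ (s≤s z≤n)

two-positive : ∀ {n} → 2 ≤ n → ∃₂ λ (r r' : Fin (suc n)) → 1 ≤ toℕ r × 1 ≤ toℕ r' × r ≢ r'
two-positive (s≤s (s≤s _)) = fsuc zero , fsuc (fsuc zero) , s≤s z≤n , s≤s z≤n , λ ()

data Split (m n : ℕ) : Fin (m + n) → Set where
  inˡ : ∀ x → Split m n (x ↑ˡ n)
  inʳ : ∀ x → Split m n (m ↑ʳ x)

split : ∀ m n (y : Fin (m + n)) → Split m n y
split m n y with splitAt m y in eq
... | inj₁ x = subst (Split m n) (splitAt⁻¹-↑ˡ eq) (inˡ x)
... | inj₂ x = subst (Split m n) (splitAt⁻¹-↑ʳ eq) (inʳ x)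

walk-map : ∀ {G S T x y} → (∀ v → S v → T v) → WalkIn G S x y → WalkIn G T x y
walk-map f (stay sx)     = stay (f _ sx)
walk-map f (step sx a w) = step (f _ sx) a (walk-map f w)

walk-head : ∀ {G S x y} → WalkIn G S x y → S x
walk-head (stay sx)     = sx
walk-head (step sx _ _) = sx

walk-leaves : ∀ {G S} (T : Fin (V G) → Set) → Decidable T → ∀ {x y} → WalkIn G S x y
  → T x → ¬ T y → ∃₂ λ a b → S a × S b × T a × ¬ T b × Adj G a b
walk-leaves T T? (stay _) tx ¬ty = contradiction tx ¬ty
walk-leaves T T? (step {x} {x'} sx a w) tx ¬ty with T? x'
... | yes tx' = walk-leaves T T? w tx' ¬ty
... | no ¬tx' = x , x' , sx , walk-head w , tx , ¬tx' , a

data Subexpr {k : ℕ} (e : CWExpr k) : CWExpr k → Set where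
  here         : Subexpr e e
  left         : ∀ {s₁ s₂} → Subexpr e (union s₁ s₂) → Subexpr e s₁
  right        : ∀ {s₁ s₂} → Subexpr e (union s₁ s₂) → Subexpr e s₂
  under-join   : ∀ {i j i≢j s} → Subexpr e (join i j i≢j s) → Subexpr e s
  under-rename : ∀ {i j s} → Subexpr e (rename i j s) → Subexpr e s

embed : ∀ {k} {e s : CWExpr k} → Subexpr e s → Fin (size s) → Fin (size e)
embed here                  x = x
embed (left {s₂ = s₂} P)    x = embed P (x ↑ˡ size s₂)
embed (right {s₁ = s₁} P)   x = embed P (size s₁ ↑ʳ x)
embed (under-join P)        x = embed P x
embed (under-rename P)      x = embed P x

module _ {k : ℕ} (s₁ s₂ : CWExpr k) where

  label-↑ˡ : ∀ x → label (union s₁ s₂) (x ↑ˡ size s₂) ≡ label s₁ x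
  label-↑ˡ x rewrite splitAt-↑ˡ (size s₁) x (size s₂) = refl

  label-↑ʳ : ∀ x → label (union s₁ s₂) (size s₁ ↑ʳ x) ≡ label s₂ x
  label-↑ʳ x rewrite splitAt-↑ʳ (size s₁) (size s₂) x = refl

  edge-↑ˡ-↑ˡ : ∀ x y → edge (union s₁ s₂) (x ↑ˡ size s₂) (y ↑ˡ size s₂) ≡ edge s₁ x y
  edge-↑ˡ-↑ˡ x y rewrite splitAt-↑ˡ (size s₁) x (size s₂) | splitAt-↑ˡ (size s₁) y (size s₂) = refl

  edge-↑ʳ-↑ʳ : ∀ x y → edge (union s₁ s₂) (size s₁ ↑ʳ x) (size s₁ ↑ʳ y) ≡ edge s₂ x y
  edge-↑ʳ-↑ʳ x y rewrite splitAt-↑ʳ (size s₁) (size s₂) x | splitAt-↑ʳ (size s₁) (size s₂) y = refl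

  edge-↑ˡ-↑ʳ : ∀ x y → ¬ edge (union s₁ s₂) (x ↑ˡ size s₂) (size s₁ ↑ʳ y)
  edge-↑ˡ-↑ʳ x y rewrite splitAt-↑ˡ (size s₁) x (size s₂) | splitAt-↑ʳ (size s₁) (size s₂) y = λ ()

  edge-↑ʳ-↑ˡ : ∀ x y → ¬ edge (union s₁ s₂) (size s₁ ↑ʳ x) (y ↑ˡ size s₂)
  edge-↑ʳ-↑ˡ x y rewrite splitAt-↑ʳ (size s₁) (size s₂) x | splitAt-↑ˡ (size s₁) y (size s₂) = λ ()

label-rename : ∀ {k} (i j : Fin k) (s : CWExpr k) x y → label s x ≡ label s y
  → label (rename i j s) x ≡ label (rename i j s) y
label-rename i j s x y eq with label s x ≟ i | label s y ≟ i
... | yes _   | yes _   = refl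
... | yes x≡i | no  y≢i = contradiction (trans (≡.sym eq) x≡i) y≢i
... | no  x≢i | yes y≡i = contradiction (trans eq y≡i) x≢i
... | no  _   | no  _   = eq

-- Above s, the vertices x and x' are only ever addressed through their common label, so x' gets
-- every edge of x that was not already built inside s.
edge-transfer : ∀ {k} {e s : CWExpr k} (P : Subexpr e s) {x x' : Fin (size s)} (z : Fin (size e))
  → label s x ≡ label s x'
  → (∀ y → embed P y ≡ z → edge s x y → edge s x' y)
  → edge e (embed P x) z → edge e (embed P x') z
edge-transfer here z _ inner = inner z refl
edge-transfer (left {s₁} {s₂} P) {x} {x'} z eq inner =
  edge-transfer P z (trans (label-↑ˡ s₁ s₂ x) (trans eq (≡.sym (label-↑ˡ s₁ s₂ x')))) inner′
  where
  inner′ : ∀ y → embed P y ≡ z → edge (union s₁ s₂) (x ↑ˡ size s₂) y → edge (union s₁ s₂) (x' ↑ˡ size s₂) y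
  inner′ y p with split (size s₁) (size s₂) y
  ... | inˡ b = subst id (≡.sym (edge-↑ˡ-↑ˡ s₁ s₂ x' b))
              ∘ inner b p ∘ subst id (edge-↑ˡ-↑ˡ s₁ s₂ x b)
  ... | inʳ b = ⊥-elim ∘ edge-↑ˡ-↑ʳ s₁ s₂ x b
edge-transfer (right {s₁} {s₂} P) {x} {x'} z eq inner =
  edge-transfer P z (trans (label-↑ʳ s₁ s₂ x) (trans eq (≡.sym (label-↑ʳ s₁ s₂ x')))) inner′
  where
  inner′ : ∀ y → embed P y ≡ z → edge (union s₁ s₂) (size s₁ ↑ʳ x) y → edge (union s₁ s₂) (size s₁ ↑ʳ x') y
  inner′ y p with split (size s₁) (size s₂) y
  ... | inʳ b = subst id (≡.sym (edge-↑ʳ-↑ʳ s₁ s₂ x' b))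
              ∘ inner b p ∘ subst id (edge-↑ʳ-↑ʳ s₁ s₂ x b)
  ... | inˡ b = ⊥-elim ∘ edge-↑ʳ-↑ˡ s₁ s₂ x b
edge-transfer (under-join {i} {j} {i≢j} {s} P) {x} {x'} z eq inner = edge-transfer P z eq inner′
  where
  inner′ : ∀ y → embed P y ≡ z → edge (join i j i≢j s) x y → edge (join i j i≢j s) x' y
  inner′ y p (inj₁ xy)                  = inj₁ (inner y p xy)
  inner′ y p (inj₂ (inj₁ (xi , yj)))    = inj₂ (inj₁ (trans (≡.sym eq) xi , yj))
  inner′ y p (inj₂ (inj₂ (xj , yi)))    = inj₂ (inj₂ (trans (≡.sym eq) xj , yi))
edge-transfer (under-rename {i} {j} {s} P) {x} {x'} z eq inner =
  edge-transfer P z (label-rename i j s x x' eq) inner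

module Realization (G : Graph) {k : ℕ} {e : CWExpr k} (R : Realizes e G) where
  open Realizes R

  _∈_ : ∀ {s} → Fin (V G) → Subexpr e s → Set
  v ∈ P = ∃ λ y → to (embed P y) ≡ v

  _∈?_ : ∀ {s} (v : Fin (V G)) (P : Subexpr e s) → Dec (v ∈ P)
  v ∈? P = any? (λ y → to (embed P y) ≟ v)

  ∈-here : ∀ v → v ∈ here
  ∈-here v = from v , to∘from v

  vertex-unique : ∀ {l} (P : Subexpr e (vertex l)) {u v} → u ∈ P → v ∈ P → u ≡ v
  vertex-unique P (zero , refl) (zero , refl) = refl

  same-label⇒same-neighbour : ∀ {s} (P : Subexpr e s) {x x' : Fin (size s)} {w : Fin (V G)}
    → label s x ≡ label s x'
    → (∀ y → embed P y ≡ from w → ¬ edge s x y)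
    → Adj G (to (embed P x)) w → Adj G (to (embed P x')) w
  same-label⇒same-neighbour P {w = w} eq not-built adj =
    subst (Adj G _) (to∘from w)
      (adj→ _ _ (edge-transfer P (from w) eq (λ y p xy → contradiction xy (not-built y p))
        (adj← _ _ (subst (Adj G _) (≡.sym (to∘from w)) adj))))

  ContainsLine : ∀ {n s} → (Fin (V G) → Fin (suc n)) → Subexpr e s → Set
  ContainsLine coord P = ∃ λ c → 1 ≤ toℕ c × (∀ v → coord v ≡ c → v ∈ P)

  containsLine? : ∀ {n s} (coord : Fin (V G) → Fin (suc n)) (P : Subexpr e s) → Dec (ContainsLine coord P)
  containsLine? coord P =
    any? λ c → (1 ≤? toℕ c) ×-dec all? (λ v → (coord v ≟ c) →-dec (v ∈? P))

  line-not-contained : ∀ {n s} (coord : Fin (V G) → Fin (suc n)) (P : Subexpr e s) c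
    → ¬ (∀ v → coord v ≡ c → v ∈ P) → ∃ λ v → coord v ≡ c × ¬ v ∈ P
  line-not-contained coord P c ¬line⊆P
    with ¬∀⟶∃¬ (V G) (λ v → coord v ≡ c → v ∈ P) (λ v → (coord v ≟ c) →-dec (v ∈? P)) ¬line⊆P
  ... | v , ¬[cv⇒v∈P] with coord v ≟ c
  ...   | yes cv  = v , cv , λ v∈P → ¬[cv⇒v∈P] λ _ → v∈P
  ...   | no cv≢c = contradiction (λ cv → contradiction cv cv≢c) ¬[cv⇒v∈P]

  module Lines {n : ℕ} (row col : Fin (V G) → Fin (suc n)) where

    HasLine : ∀ {s} → Subexpr e s → Set
    HasLine P = ContainsLine row P ⊎ ContainsLine col P

    record MinimalUnion : Set where
      field
        {s₁ s₂}    : CWExpr k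
        node       : Subexpr e (union s₁ s₂)
        line       : HasLine node
        left-free  : ¬ HasLine (left node)
        right-free : ¬ HasLine (right node)

    minimal-union : (∀ {l} (P : Subexpr e (vertex l)) → ¬ HasLine P)
      → ∀ {s} (P : Subexpr e s) → HasLine P → MinimalUnion
    minimal-union leaf-free {vertex l} P line = contradiction line (leaf-free P)
    minimal-union leaf-free {union s₁ s₂} P line
      with containsLine? row (left P) ⊎-dec containsLine? col (left P)
         | containsLine? row (right P) ⊎-dec containsLine? col (right P)
    ... | yes left-line | _          = minimal-union leaf-free (left P) left-line
    ... | no _          | yes right-line = minimal-union leaf-free (right P) right-line
    ... | no left-free  | no right-free  = record
      { node = P ; line = line ; left-free = left-free ; right-free = right-free }
    minimal-union leaf-free {join i j i≢j s} P line = minimal-union leaf-free (under-join P) line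
    minimal-union leaf-free {rename i j s} P line = minimal-union leaf-free (under-rename P) line

-- Conditions (2), (3), (5), (7), (8) in terms of the coordinates row and col; swapping the
-- coordinates turns (1), (3), (4), (6), (8) into the same shape.
record GridAxioms (m n : ℕ) (G : Graph) (row col : Fin (V G) → Fin (suc n)) : Set where
  field
    row-zero-unique    : ∀ c → 1 ≤ toℕ c → ∀ x y
      → row x ≡ zero → col x ≡ c → row y ≡ zero → col y ≡ c → x ≡ y
    cell-inhabited     : ∀ r c → 1 ≤ toℕ r → 1 ≤ toℕ c → ∃ λ x → row x ≡ r × col x ≡ c
    column-connected   : ∀ c → 1 ≤ toℕ c → InducedConnected G (λ x → col x ≡ c)
    row-zero-adjacency : ∀ {x y} → row x ≡ zero → 1 ≤ toℕ (col x) → 1 ≤ toℕ (row y) → 1 ≤ toℕ (col y)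
      → Adj G x y → toℕ (col y) ≤ toℕ (col x)
    column-distance    : ∀ {x y} → 1 ≤ toℕ (row x) → 1 ≤ toℕ (col x) → 1 ≤ toℕ (row y) → 1 ≤ toℕ (col y)
      → Adj G x y → ∣ toℕ (col y) - toℕ (col x) ∣ ≤ m

module Grid {m n : ℕ} (2≤n : 2 ≤ n) {G : Graph} {row col : Fin (V G) → Fin (suc n)}
            (axioms : GridAxioms m n G row col) {k : ℕ} {e : CWExpr k} (R : Realizes e G) where
  open GridAxioms axioms
  open Realizes R
  open Realization G R

  _≪_ : Fin (suc n) → Fin (suc n) → Set
  c ≪ c' = toℕ c + suc m ≤ toℕ c'

  ≪-positive : ∀ {c c'} → 1 ≤ toℕ c → c ≪ c' → 1 ≤ toℕ c'
  ≪-positive {c} c≥1 far = ≤-trans c≥1 (m+n≤o⇒m≤o (toℕ c) far)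

  far-neighbour-in-row-zero : ∀ {x y} → 1 ≤ toℕ (col x) → col x ≪ col y → Adj G x y → row y ≡ zero
  far-neighbour-in-row-zero {x} {y} cx≥1 far adj with zero-or-positive (row y) | zero-or-positive (row x)
  ... | inj₁ ry≡0 | _         = ry≡0
  ... | inj₂ ry≥1 | inj₁ rx≡0 = contradiction
    (row-zero-adjacency rx≡0 cx≥1 ry≥1 (≪-positive cx≥1 far) adj) (m+[1+o]≤n⇒n≰m m far)
  ... | inj₂ ry≥1 | inj₂ rx≥1 = contradiction
    (column-distance rx≥1 cx≥1 ry≥1 (≪-positive cx≥1 far) adj) (m+[1+o]≤n⇒∣n-m∣≰o m far)

  -- An edge of column c with one end built by s that s has not built yet: it can only be
  -- created above s, through the label of that end.
  record PendingEdge {s} (P : Subexpr e s) (c : Fin (suc n)) : Set where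
    field
      inner     : Fin (size s)
      outer     : Fin (V G)
      inner-col : col (to (embed P inner)) ≡ c
      outer-col : col outer ≡ c
      adjacent  : Adj G (to (embed P inner)) outer
      unbuilt   : ∀ y → embed P y ≡ from outer → ¬ edge s inner y

  column-leaves : ∀ {s} (P : Subexpr e s) {c} → 1 ≤ toℕ c
    → (∃ λ x → col x ≡ c × x ∈ P) → (∃ λ v → col v ≡ c × ¬ v ∈ P) → PendingEdge P c
  column-leaves P {c} c≥1 (x , cx , x∈P) (v , cv , v∉P)
    with walk-leaves (_∈ P) (_∈? P) (column-connected c c≥1 x v cx cv) x∈P v∉P
  ... | a , b , ca , cb , (y , refl) , b∉P , adj = record
    { inner = y ; outer = b ; inner-col = ca ; outer-col = cb ; adjacent = adj
    ; unbuilt = λ y' p _ → b∉P (y' , trans (cong to p) (to∘from b)) }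

  pending-edge-left : ∀ {s₁ s₂} {P : Subexpr e (union s₁ s₂)} {c} → PendingEdge (left P) c → PendingEdge P c
  pending-edge-left {s₁} {s₂} {P} {c} pe = record
    { inner = inner ↑ˡ size s₂ ; outer = outer ; inner-col = inner-col ; outer-col = outer-col
    ; adjacent = adjacent ; unbuilt = unbuilt′ }
    where
    open PendingEdge pe
    unbuilt′ : ∀ y → embed P y ≡ from outer → ¬ edge (union s₁ s₂) (inner ↑ˡ size s₂) y
    unbuilt′ y p with split (size s₁) (size s₂) y
    ... | inˡ b = unbuilt b p ∘ subst id (edge-↑ˡ-↑ˡ s₁ s₂ inner b)
    ... | inʳ b = edge-↑ˡ-↑ʳ s₁ s₂ inner b

  pending-edge-right : ∀ {s₁ s₂} {P : Subexpr e (union s₁ s₂)} {c} → PendingEdge (right P) c → PendingEdge P c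
  pending-edge-right {s₁} {s₂} {P} {c} pe = record
    { inner = size s₁ ↑ʳ inner ; outer = outer ; inner-col = inner-col ; outer-col = outer-col
    ; adjacent = adjacent ; unbuilt = unbuilt′ }
    where
    open PendingEdge pe
    unbuilt′ : ∀ y → embed P y ≡ from outer → ¬ edge (union s₁ s₂) (size s₁ ↑ʳ inner) y
    unbuilt′ y p with split (size s₁) (size s₂) y
    ... | inʳ b = unbuilt b p ∘ subst id (edge-↑ʳ-↑ʳ s₁ s₂ inner b)
    ... | inˡ b = edge-↑ʳ-↑ˡ s₁ s₂ inner b

  module _ {s} {P : Subexpr e s} {c c' : Fin (suc n)} (pe : PendingEdge P c) (pe' : PendingEdge P c') where
    open PendingEdge pe
    open PendingEdge pe' renaming (inner to inner'; outer to outer'; inner-col to inner-col';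
      outer-col to outer-col'; adjacent to adjacent'; unbuilt to unbuilt')

    far-pending-edges-differ : 1 ≤ toℕ c → c ≪ c' → label s inner ≢ label s inner'
    far-pending-edges-differ c≥1 far same =
      irrefl G (subst (Adj G (to (embed P inner'))) (≡.sym inner'≡outer') adjacent')
      where
      c'≥1 : 1 ≤ toℕ c'
      c'≥1 = ≪-positive c≥1 far
      crossed  : Adj G (to (embed P inner')) outer
      crossed  = same-label⇒same-neighbour P same unbuilt adjacent
      crossed' : Adj G (to (embed P inner)) outer'
      crossed' = same-label⇒same-neighbour P (≡.sym same) unbuilt' adjacent'
      outer'-row : row outer' ≡ zero
      outer'-row = far-neighbour-in-row-zero
        (subst (λ d → 1 ≤ toℕ d) (≡.sym inner-col) c≥1)
        (subst₂ _≪_ (≡.sym inner-col) (≡.sym outer-col') far) crossed'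
      inner'-row : row (to (embed P inner')) ≡ zero
      inner'-row = far-neighbour-in-row-zero
        (subst (λ d → 1 ≤ toℕ d) (≡.sym outer-col) c≥1)
        (subst₂ _≪_ (≡.sym outer-col) (≡.sym inner-col') far) (sym G crossed)
      inner'≡outer' : to (embed P inner') ≡ outer'
      inner'≡outer' = row-zero-unique c' c'≥1 _ _ inner'-row inner-col' outer'-row outer-col'

  pending-edge-at-every-column : ∀ {s₁ s₂} (P : Subexpr e (union s₁ s₂))
    → ContainsLine row P → ¬ ContainsLine col (left P) → ¬ ContainsLine col (right P)
    → ∀ c → 1 ≤ toℕ c → PendingEdge P c
  pending-edge-at-every-column {s₁} {s₂} P (a , a≥1 , row⊆P) ¬left ¬right c c≥1
    with cell-inhabited a c a≥1 c≥1
  ... | x , ra , cx with row⊆P x ra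
  ...   | y , refl with split (size s₁) (size s₂) y
  ...     | inˡ b = pending-edge-left (column-leaves (left P) c≥1 (_ , cx , b , refl)
                      (line-not-contained col (left P) c λ col⊆ → ¬left (c , c≥1 , col⊆)))
  ...     | inʳ b = pending-edge-right (column-leaves (right P) c≥1 (_ , cx , b , refl)
                      (line-not-contained col (right P) c λ col⊆ → ¬right (c , c≥1 , col⊆)))

  spaced-column< : (t : Fin (suc ((n ∸ 1) / suc m))) → suc (toℕ t * suc m) < suc n
  spaced-column< t = begin
    suc (suc (toℕ t * suc m))            ≤⟨ s≤s (s≤s (*-monoˡ-≤ (suc m) (m<1+n⇒m≤n (toℕ<n t)))) ⟩
    suc (suc ((n ∸ 1) / suc m * suc m))  ≤⟨ s≤s (s≤s (m/n*n≤m (n ∸ 1) (suc m))) ⟩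
    suc (suc (n ∸ 1))                    ≡⟨ cong suc (m+[n∸m]≡n (≤-trans (s≤s z≤n) 2≤n)) ⟩
    suc n                                ∎
    where open ≤-Reasoning

  spaced-column : Fin (suc ((n ∸ 1) / suc m)) → Fin (suc n)
  spaced-column t = fromℕ< (spaced-column< t)

  toℕ-spaced-column : ∀ t → toℕ (spaced-column t) ≡ suc (toℕ t * suc m)
  toℕ-spaced-column t = toℕ-fromℕ< (spaced-column< t)

  spaced-column-positive : ∀ t → 1 ≤ toℕ (spaced-column t)
  spaced-column-positive t = subst (1 ≤_) (≡.sym (toℕ-spaced-column t)) (s≤s z≤n)

  spaced-column-≪ : ∀ {t t'} → t <ᶠ t' → spaced-column t ≪ spaced-column t'
  spaced-column-≪ {t} {t'} t<t' =
    subst₂ (λ a b → a + suc m ≤ b) (≡.sym (toℕ-spaced-column t)) (≡.sym (toℕ-spaced-column t'))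
      (s≤s (subst (_≤ toℕ t' * suc m) (+-comm (suc m) (toℕ t * suc m)) (*-monoˡ-≤ (suc m) t<t')))

  width-bound : ∀ {s₁ s₂} (P : Subexpr e (union s₁ s₂))
    → ContainsLine row P → ¬ ContainsLine col (left P) → ¬ ContainsLine col (right P)
    → (n ∸ 1) / suc m + 1 ≤ k
  width-bound {s₁} {s₂} P row⊆P ¬left ¬right =
    subst (_≤ k) (+-comm 1 ((n ∸ 1) / suc m)) (≮⇒≥ too-few-labels)
    where
    pending : ∀ t → PendingEdge P (spaced-column t)
    pending t = pending-edge-at-every-column P row⊆P ¬left ¬right _ (spaced-column-positive t)
    pending-label : Fin (suc ((n ∸ 1) / suc m)) → Fin k
    pending-label t = label (union s₁ s₂) (PendingEdge.inner (pending t))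
    too-few-labels : ¬ k < suc ((n ∸ 1) / suc m)
    too-few-labels k<cols with pigeonhole k<cols pending-label
    ... | t , t' , t<t' , same =
      far-pending-edges-differ (pending t) (pending t')
        (spaced-column-positive t) (spaced-column-≪ t<t') same

  column-not-in-leaf : ∀ {l} (P : Subexpr e (vertex l)) → ¬ ContainsLine col P
  column-not-in-leaf P (c , c≥1 , col⊆P) with two-positive 2≤n
  ... | r , r' , r≥1 , r'≥1 , r≢r' with cell-inhabited r c r≥1 c≥1 | cell-inhabited r' c r'≥1 c≥1
  ...   | x , rx , cx | y , ry , cy =
    r≢r' (trans (≡.sym rx) (trans (cong row (vertex-unique P (col⊆P x cx) (col⊆P y cy))) ry))

theorem3 : (m n : ℕ) → suc m < n → (G : Graph)
  → (part : Fin (V G) → Fin (suc n) × Fin (suc n))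
  → (∀ (i : Fin (suc n)) → 1 ≤ toℕ i → ∀ x y → part x ≡ (i , zero) → part y ≡ (i , zero) → x ≡ y)
  → (∀ (j : Fin (suc n)) → 1 ≤ toℕ j → ∀ x y → part x ≡ (zero , j) → part y ≡ (zero , j) → x ≡ y)
  → (∀ (i j : Fin (suc n)) → 1 ≤ toℕ i → 1 ≤ toℕ j → ∃ λ x → part x ≡ (i , j))
  → (∀ (i : Fin (suc n)) → 1 ≤ toℕ i
      → InducedConnected G (λ x → ∃ λ j → part x ≡ (i , j)))
  → (∀ (j : Fin (suc n)) → 1 ≤ toℕ j
      → InducedConnected G (λ x → ∃ λ i → part x ≡ (i , j)))
  → (∀ (i j k : Fin (suc n)) → 1 ≤ toℕ i → 1 ≤ toℕ j → 1 ≤ toℕ k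
      → ∀ x y → part x ≡ (k , zero) → part y ≡ (i , j) → Adj G x y → toℕ i ≤ toℕ k)
  → (∀ (i j k : Fin (suc n)) → 1 ≤ toℕ i → 1 ≤ toℕ j → 1 ≤ toℕ k
      → ∀ x y → part x ≡ (zero , k) → part y ≡ (i , j) → Adj G x y → toℕ j ≤ toℕ k)
  → (∀ (i j k l : Fin (suc n)) → 1 ≤ toℕ i → 1 ≤ toℕ j → 1 ≤ toℕ k → 1 ≤ toℕ l
      → ∀ x y → part x ≡ (i , j) → part y ≡ (k , l) → Adj G x y
      → ∣ toℕ k - toℕ i ∣ ≤ m × ∣ toℕ l - toℕ j ∣ ≤ m)
  → CliqueWidthAtLeast G ((n ∸ 1) / suc m + 1)
theorem3 m n m+1<n G part h1 h2 h3 h4 h5 h6 h7 h8 k e R =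
  bound (minimal-union leaf-free here root-line)
  where
  open Realization G R
  row-of col-of : Fin (V G) → Fin (suc n)
  row-of = proj₁ ∘ part
  col-of = proj₂ ∘ part
  open Lines row-of col-of

  2≤n : 2 ≤ n
  2≤n = ≤-trans (s≤s (s≤s z≤n)) m+1<n

  rows : GridAxioms m n G row-of col-of
  rows = record
    { row-zero-unique    = λ c c≥1 x y rx cx ry cy → h2 c c≥1 x y (cong₂ _,_ rx cx) (cong₂ _,_ ry cy)
    ; cell-inhabited     = λ r c r≥1 c≥1 → let (x , p) = h3 r c r≥1 c≥1 in x , cong proj₁ p , cong proj₂ p
    ; column-connected   = λ c c≥1 x y cx cy → walk-map (λ _ (_ , p) → cong proj₂ p)
                             (h5 c c≥1 x y (row-of x , cong (row-of x ,_) cx) (row-of y , cong (row-of y ,_) cy))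
    ; row-zero-adjacency = λ {x} {y} rx cx≥1 ry≥1 cy≥1 →
                             h7 (row-of y) (col-of y) (col-of x) ry≥1 cy≥1 cx≥1 x y (cong (_, col-of x) rx) refl
    ; column-distance    = λ {x} {y} rx≥1 cx≥1 ry≥1 cy≥1 →
                             proj₂ ∘ h8 (row-of x) (col-of x) (row-of y) (col-of y) rx≥1 cx≥1 ry≥1 cy≥1 x y refl refl
    }

  columns : GridAxioms m n G col-of row-of
  columns = record
    { row-zero-unique    = λ c c≥1 x y rx cx ry cy → h1 c c≥1 x y (cong₂ _,_ cx rx) (cong₂ _,_ cy ry)
    ; cell-inhabited     = λ r c r≥1 c≥1 → let (x , p) = h3 c r c≥1 r≥1 in x , cong proj₂ p , cong proj₁ p
    ; column-connected   = λ c c≥1 x y cx cy → walk-map (λ _ (_ , p) → cong proj₁ p)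
                             (h4 c c≥1 x y (col-of x , cong (_, col-of x) cx) (col-of y , cong (_, col-of y) cy))
    ; row-zero-adjacency = λ {x} {y} rx cx≥1 ry≥1 cy≥1 →
                             h6 (row-of y) (col-of y) (row-of x) cy≥1 ry≥1 cx≥1 x y (cong (row-of x ,_) rx) refl
    ; column-distance    = λ {x} {y} rx≥1 cx≥1 ry≥1 cy≥1 →
                             proj₁ ∘ h8 (row-of x) (col-of x) (row-of y) (col-of y) cx≥1 rx≥1 cy≥1 ry≥1 x y refl refl
    }

  module Rows = Grid 2≤n rows R
  module Columns = Grid 2≤n columns R

  root-line : HasLine here
  root-line with two-positive 2≤n
  ... | r , _ , r≥1 , _ = inj₁ (r , r≥1 , λ v _ → ∈-here v)

  leaf-free : ∀ {l} (P : Subexpr e (vertex l)) → ¬ HasLine P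
  leaf-free P = [ Columns.column-not-in-leaf P , Rows.column-not-in-leaf P ]′

  bound : MinimalUnion → (n ∸ 1) / suc m + 1 ≤ k
  bound record { node = P ; line = inj₁ row⊆P ; left-free = ¬l ; right-free = ¬r } =
    Rows.width-bound P row⊆P (¬l ∘ inj₂) (¬r ∘ inj₂)
  bound record { node = P ; line = inj₂ col⊆P ; left-free = ¬l ; right-free = ¬r } =
    Columns.width-bound P col⊆P (¬l ∘ inj₁) (¬r ∘ inj₁)
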